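{- Let $\nu$ be a lattice path from $(0,0)$ to $(s_E,s_N)$, let $D$ be a $\nu$-Dyck path and let $i\in[s_N]$. Then $D\downarrow_i$ exists and $D\downarrow_i \lessdot_T D$ (i.e. $D$ covers $D\downarrow_i$ in the $\nu$-Tamari order) if and only if $t_i^D=h_i^D$ and $\mathrm{horiz}_\nu(r_i^D)\neq 0$.
   Context: Let $\nu$ be a lattice path from $(0,0)$ to $(s_E,s_N)$ with unit north ($N$) and east ($E$) steps. A $\nu$-Dyck path is a lattice path from $(0,0)$ to $(s_E,s_N)$ with $N$ and $E$ steps lying weakly above $\nu$; $\mathcal D_\nu$ denotes the set of them. A path is viewed as the sequence of lattice points it visits. For $i\in[s_N]$, $r_i^D$ is the point of $D$ immediately before the $i$-th north step of $D$. For a point $p=(x,y)$ on $D$, $\mathrm{horiz}_\nu(p)=X(y)-x$, where $X(y)$ is the largest $x$-coordinate of a point of $\nu$ at height $y$ (the maximal number of east steps one can take from $p$ while staying weakly above $\nu$). The touch point $t_i^D$ is the first point of $D$ after $r_i^D$ with $\mathrm{horiz}_\nu(t_i^D)=\mathrm{horiz}_\nu(r_i^D)$; the hit point $h_i^D$ is the first point of $D$ after $r_i^D$ with $\mathrm{horiz}_\nu(h_i^D)=\mathrm{horiz}_\nu(r_i^D)$ that is either followed by an east step in $D$ or is the final point $(s_E,s_N)$. $\nu$-Tamari order: if $r_i^D$ is preceded by an east step, write $D=dEtf$, where $dE$ is the subpath from $(0,0)$ to $r_i^D$, $t$ the subpath from $r_i^D$ to $t_i^D$ and $f$ the subpath from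 $t_i^D$ to the end, and put $D\uparrow_i=dtEf$. The $\nu$-Tamari order $\le_T$ on $\mathcal D_\nu$ is the partial order whose cover relations are exactly $D\lessdot_T D\uparrow_i$ whenever $D\uparrow_i$ is defined. Going down: if $t_i^D=h_i^D$ and $h_i^D$ is followed by an east step, write $D=dtEf$ with $d$ the subpath from $(0,0)$ to $r_i^D$, $t$ the subpath from $r_i^D$ to $h_i^D$, and $Ef$ the subpath from $h_i^D$ to the end; then $D\downarrow_i$ denotes the path $dEtf$ (when it is a $\nu$-Dyck path). -}

module Defs where

open import Data.Nat using (ℕ; zero; suc; _+_; _∸_; _≤_; _<_)
open import Data.List using (List; []; _∷_; _++_; length; take; drop)
open import Data.Maybe using (Maybe; just; nothing)
open import Data.Product using (_×_; _,_; ∃; ∃-syntax; Σ-syntax)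
open import Data.Sum using (_⊎_)
open import Data.Empty using (⊥)
open import Relation.Binary.PropositionalEquality using (_≡_; _≢_)

data Step : Set where
  N E : Step

-- A lattice path from (0,0), given by its sequence of steps.
-- Its lattice points are indexed 0 .. length P (point k = after k steps).
Path : Set
Path = List Step

countN : Path → ℕ
countN []       = 0
countN (N ∷ p) = suc (countN p)
countN (E ∷ p) = countN p

countE : Path → ℕ
countE []       = 0
countE (N ∷ p) = countE p
countE (E ∷ p) = suc (countE p)

Point : Set
Point = ℕ × ℕ

pt : Path → ℕ → Point
pt P k = countE (take k P) , countN (take k P)

stepAt : Path → ℕ → Maybe Step
stepAt []      _       = nothing
stepAt (s ∷ P) zero    = just s
stepAt (s ∷ P) (suc k) = stepAt P k

-- X ν y : largest x-coordinate of a point of ν at height y (y ≤ s_N)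
X : Path → ℕ → ℕ
X []      y       = 0
X (E ∷ ν) y       = suc (X ν y)
X (N ∷ ν) zero    = 0
X (N ∷ ν) (suc y) = X ν y

horiz : Path → Point → ℕ
horiz ν (x , y) = X ν y ∸ x

-- ν-Dyck path: same endpoint (s_E, s_N) as ν, every point weakly above ν
-- (i.e. each point (x,y) of D has x ≤ X(y)).
IsDyck : Path → Path → Set
IsDyck ν D = countE D ≡ countE ν × countN D ≡ countN ν
           × (∀ k → k ≤ length D → let (x , y) = pt D k in x ≤ X ν y)

-- k is the index of r_i^D : the point immediately before the i-th north step
-- (i ≥ 1), i.e. the step leaving point k is N and it is preceded by i-1 north steps.
RIdx : Path → ℕ → ℕ → Set
RIdx D i k = stepAt D k ≡ just N × suc (countN (take k D)) ≡ i

-- m is the index of the touch point t_i^D, where k is the index of r_i^D: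
-- first point after r_i^D with the same horiz value.
TIdx : Path → Path → ℕ → ℕ → Set
TIdx ν D k m = k < m × m ≤ length D
             × horiz ν (pt D m) ≡ horiz ν (pt D k)
             × (∀ j → k < j → j < m → horiz ν (pt D j) ≢ horiz ν (pt D k))

EndOrE : Path → ℕ → Set
EndOrE D m = stepAt D m ≡ just E ⊎ m ≡ length D

HIdx : Path → Path → ℕ → ℕ → Set
HIdx ν D k m = k < m × m ≤ length D
             × horiz ν (pt D m) ≡ horiz ν (pt D k) × EndOrE D m
             × (∀ j → k < j → j < m → horiz ν (pt D j) ≡ horiz ν (pt D k)
                   → EndOrE D j → ⊥)

-- Up D i D' : r_i^D is preceded by an east step and D' = D↑_i
-- (D = d E t f with dE ending at r_i^D, t from r_i^D to t_i^D; D' = d t E f).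
Up : Path → Path → ℕ → Path → Set
Up ν D i D' = Σ[ d ∈ Path ] Σ[ t ∈ Path ] Σ[ f ∈ Path ]
    D ≡ d ++ E ∷ t ++ f
  × RIdx D i (suc (length d))
  × TIdx ν D (suc (length d)) (suc (length d) + length t)
  × D' ≡ d ++ t ++ E ∷ f

-- Cover relation of the ν-Tamari order: D ⋖_T D' iff D' = D↑_i for some i ∈ [s_N].
Covers : Path → Path → Path → Set
Covers ν D D' = IsDyck ν D × IsDyck ν D'
              × ∃[ i ] (1 ≤ i × i ≤ countN ν × Up ν D i D')

-- Down D i D' : D↓_i exists and equals D'. Requires t_i^D = h_i^D, h_i^D followed
-- by an east step; D = d t E f (d to r_i^D, t from r_i^D to h_i^D), D' = d E t f,
-- and D' is a ν-Dyck path.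
Down : Path → Path → ℕ → Path → Set
Down ν D i D' = Σ[ d ∈ Path ] Σ[ t ∈ Path ] Σ[ f ∈ Path ]
    D ≡ d ++ t ++ E ∷ f
  × RIdx D i (length d)
  × TIdx ν D (length d) (length d + length t)
  × HIdx ν D (length d) (length d + length t)
  × D' ≡ d ++ E ∷ t ++ f
  × IsDyck ν D'

TouchIsHitNonzero : Path → Path → ℕ → Set
TouchIsHitNonzero ν D i = ∃[ k ] ∃[ m ] ∃[ m' ]
    RIdx D i k × TIdx ν D k m × HIdx ν D k m'
  × pt D m ≡ pt D m' × horiz ν (pt D k) ≢ 0

{-# OPTIONS --safe #-}
-- Write D = d t E f, where d ends at r_i and t ends at the touch point, so that
-- D↓_i = d E t f: its points are those of D, except that the points of t move
-- one unit east, which lowers their horiz by one. As t starts with a north step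
-- and horiz drops (by one) only along east steps, horiz ≥ horiz(r_i) on all of t.
-- So if horiz(r_i) ≠ 0, the shifted t stays weakly above ν, and lowering horiz
-- by one is injective on t; hence the shifted r_i and touch point are those of
-- D↓_i, i.e. (D↓_i)↑_i = D. Conversely, the point of D↓_i one unit east of r_i
-- lies weakly above ν, which forces horiz(r_i) ≥ 1. Finally, a hit point with
-- nonzero horiz is not the final point (where horiz vanishes), so it is followed
-- by an east step.
module Submission where

open import Defs
open import Data.Nat using (ℕ; zero; suc; pred; _+_; _∸_; _≤_; _<_; _≤?_; z≤n; s≤s; ≢-nonZero)
open import Data.Nat.Properties
open import Data.List using (List; []; _∷_; _++_; length; take)
open import Data.List.Properties using (length-++; take-all)
open import Data.Maybe using (just)
open import Data.Product using (_×_; _,_; proj₁; proj₂; ∃-syntax; Σ-syntax)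
open import Data.Sum using (inj₁; inj₂)
open import Data.Empty using (⊥-elim)
open import Function using (_∘_)
open import Function.Bundles using (_⇔_; mk⇔)
open import Relation.Nullary using (yes; no)
open import Relation.Binary.PropositionalEquality

east north : Point → Point
east  (x , y) = suc x , y
north (x , y) = x , suc y

Above : Path → Point → Set
Above ν (x , y) = x ≤ X ν y

take-++-≤ : ∀ {A : Set} n (p q : List A) → n ≤ length p → take n (p ++ q) ≡ take n p
take-++-≤ zero    p       q _         = refl
take-++-≤ (suc n) (s ∷ p) q (s≤s n≤p) = cong (s ∷_) (take-++-≤ n p q n≤p)

pt-++-≤ : ∀ p q {n} → n ≤ length p → pt (p ++ q) n ≡ pt p n
pt-++-≤ p q {n} n≤p = cong (λ u → countE u , countN u) (take-++-≤ n p q n≤p)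

pt-length : ∀ P → pt P (length P) ≡ (countE P , countN P)
pt-length P = cong (λ u → countE u , countN u) (take-all (length P) P ≤-refl)

pt-coordinate-sum : ∀ P {j} → j ≤ length P → proj₁ (pt P j) + proj₂ (pt P j) ≡ j
pt-coordinate-sum P       {zero}  _         = refl
pt-coordinate-sum (E ∷ P) {suc j} (s≤s j≤P) = cong suc (pt-coordinate-sum P j≤P)
pt-coordinate-sum (N ∷ P) {suc j} (s≤s j≤P) =
  trans (+-suc (proj₁ (pt P j)) _) (cong suc (pt-coordinate-sum P j≤P))

pt-injective : ∀ P {m m′} → m ≤ length P → m′ ≤ length P → pt P m ≡ pt P m′ → m ≡ m′
pt-injective P {m} {m′} m≤P m′≤P same = begin
  m                                   ≡⟨ sym (pt-coordinate-sum P m≤P) ⟩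
  proj₁ (pt P m) + proj₂ (pt P m)     ≡⟨ cong (λ p → proj₁ p + proj₂ p) same ⟩
  proj₁ (pt P m′) + proj₂ (pt P m′)   ≡⟨ pt-coordinate-sum P m′≤P ⟩
  m′                                  ∎
  where open ≡-Reasoning

stepAt-defined : ∀ P {j} → j < length P → ∃[ s ] stepAt P j ≡ just s
stepAt-defined (s ∷ P) {zero}  _         = s , refl
stepAt-defined (_ ∷ P) {suc j} (s≤s j<P) = stepAt-defined P j<P

stepAt-++-< : ∀ p q {n} → n < length p → stepAt (p ++ q) n ≡ stepAt p n
stepAt-++-< (_ ∷ p) q {zero}  _         = refl
stepAt-++-< (_ ∷ p) q {suc n} (s≤s n<p) = stepAt-++-< p q n<p

pt-suc-N : ∀ P {j} → stepAt P j ≡ just N → pt P (suc j) ≡ north (pt P j)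
pt-suc-N (N ∷ P) {zero}  _      = refl
pt-suc-N (N ∷ P) {suc j} step-N = cong north (pt-suc-N P step-N)
pt-suc-N (E ∷ P) {suc j} step-N = cong east  (pt-suc-N P step-N)

pt-suc-E : ∀ P {j} → stepAt P j ≡ just E → pt P (suc j) ≡ east (pt P j)
pt-suc-E (E ∷ P) {zero}  _      = refl
pt-suc-E (N ∷ P) {suc j} step-E = cong north (pt-suc-E P step-E)
pt-suc-E (E ∷ P) {suc j} step-E = cong east  (pt-suc-E P step-E)

split-at-E : ∀ P {m} → stepAt P m ≡ just E →
  Σ[ t ∈ Path ] Σ[ f ∈ Path ] P ≡ t ++ E ∷ f × length t ≡ m
split-at-E (E ∷ P) {zero}  refl = [] , P , refl , refl
split-at-E (s ∷ P) {suc m} step-E with split-at-E P step-E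
... | t , f , refl , refl = s ∷ t , f , refl , refl

split-before-E : ∀ P {k m} → k ≤ m → stepAt P m ≡ just E →
  Σ[ d ∈ Path ] Σ[ t ∈ Path ] Σ[ f ∈ Path ]
    P ≡ d ++ t ++ E ∷ f × length d ≡ k × length d + length t ≡ m
split-before-E P z≤n step-E with split-at-E P step-E
... | t , f , refl , refl = [] , t , f , refl , refl , refl
split-before-E (s ∷ P) (s≤s k≤m) step-E with split-before-E P k≤m step-E
... | d , t , f , refl , refl , refl = s ∷ d , t , f , refl , refl , refl

X-mono-suc : ∀ ν y → X ν y ≤ X ν (suc y)
X-mono-suc []      y       = z≤n
X-mono-suc (E ∷ ν) y       = s≤s (X-mono-suc ν y)
X-mono-suc (N ∷ ν) zero    = z≤n
X-mono-suc (N ∷ ν) (suc y) = X-mono-suc ν y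

X-countN : ∀ ν → X ν (countN ν) ≡ countE ν
X-countN []      = refl
X-countN (E ∷ ν) = cong suc (X-countN ν)
X-countN (N ∷ ν) = X-countN ν

horiz-north : ∀ ν p → horiz ν p ≤ horiz ν (north p)
horiz-north ν (x , y) = ∸-monoˡ-≤ x (X-mono-suc ν y)

horiz-east : ∀ ν p → horiz ν (east p) ≡ pred (horiz ν p)
horiz-east ν (x , y) = sym (pred[m∸n]≡m∸[1+n] (X ν y) x)

Above-east⇒horiz≢0 : ∀ ν p → Above ν (east p) → horiz ν p ≢ 0
Above-east⇒horiz≢0 ν p = m>n⇒m∸n≢0

horiz≢0⇒Above-east : ∀ ν p → horiz ν p ≢ 0 → Above ν (east p)
horiz≢0⇒Above-east ν p = m∸n≢0⇒n<m

horiz-end : ∀ ν {D} → IsDyck ν D → horiz ν (pt D (length D)) ≡ 0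
horiz-end ν {D} (E≡ , N≡ , _) = begin
  horiz ν (pt D (length D))   ≡⟨ cong (horiz ν) (pt-length D) ⟩
  X ν (countN D) ∸ countE D   ≡⟨ cong₂ (λ y x → X ν y ∸ x) N≡ E≡ ⟩
  X ν (countN ν) ∸ countE ν   ≡⟨ cong (_∸ countE ν) (X-countN ν) ⟩
  countE ν ∸ countE ν         ≡⟨ n∸n≡0 (countE ν) ⟩
  0                           ∎
  where open ≡-Reasoning

EndOrE⇒E : ∀ ν {D m} → IsDyck ν D → horiz ν (pt D m) ≢ 0 → EndOrE D m →
  stepAt D m ≡ just E
EndOrE⇒E _ _  _   (inj₁ step-E) = step-E
EndOrE⇒E ν dy h≢0 (inj₂ refl)   = ⊥-elim (h≢0 (horiz-end ν dy))

horiz-≥-until-touch : ∀ ν {D k m} → stepAt D k ≡ just N → TIdx ν D k m →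
  ∀ j → k ≤ j → j ≤ m → horiz ν (pt D k) ≤ horiz ν (pt D j)
horiz-≥-until-touch ν {D} {k} {m} step-N (_ , m≤D , _ , no-earlier) = go
  where
  go : ∀ j → k ≤ j → j ≤ m → horiz ν (pt D k) ≤ horiz ν (pt D j)
  go j k≤j _ with m≤n⇒m<n∨m≡n k≤j
  go j       _ _   | inj₂ refl       = ≤-refl
  go (suc j) _ j<m | inj₁ (s≤s k≤j) = step (stepAt-defined D (<-≤-trans j<m m≤D))
    where
    IH : horiz ν (pt D k) ≤ horiz ν (pt D j)
    IH = go j k≤j (<⇒≤ j<m)
    step : ∃[ s ] stepAt D j ≡ just s → horiz ν (pt D k) ≤ horiz ν (pt D (suc j))
    step (N , j-north) = begin
      horiz ν (pt D k)          ≤⟨ IH ⟩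
      horiz ν (pt D j)          ≤⟨ horiz-north ν (pt D j) ⟩
      horiz ν (north (pt D j))  ≡⟨ cong (horiz ν) (sym (pt-suc-N D j-north)) ⟩
      horiz ν (pt D (suc j))    ∎
      where open ≤-Reasoning
    step (E , j-east) = begin
      horiz ν (pt D k)          ≤⟨ <⇒≤pred (≤∧≢⇒< IH (≢-sym (no-earlier j k<j j<m))) ⟩
      pred (horiz ν (pt D j))   ≡⟨ sym (horiz-east ν (pt D j)) ⟩
      horiz ν (east (pt D j))   ≡⟨ cong (horiz ν) (sym (pt-suc-E D j-east)) ⟩
      horiz ν (pt D (suc j))    ∎
      where
      open ≤-Reasoning
      k≢j : k ≢ j
      k≢j refl with trans (sym step-N) j-east
      ... | ()
      k<j : k < j
      k<j = ≤∧≢⇒< k≤j k≢j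

pt-E-past : ∀ t f {n} → length t < n → pt (E ∷ t ++ f) n ≡ pt (t ++ E ∷ f) n
pt-E-past []      f _                              = refl
pt-E-past (N ∷ t) f {suc (suc n)} (s≤s (s≤s t≤n)) = cong north (pt-E-past t f (s≤s t≤n))
pt-E-past (E ∷ t) f {suc (suc n)} (s≤s (s≤s t≤n)) = cong east  (pt-E-past t f (s≤s t≤n))

module Lower (d t f : Path) where

  D D↓ : Path
  D  = d ++ t ++ E ∷ f
  D↓ = d ++ E ∷ t ++ f

  pt-before : ∀ {n} → n ≤ length d → pt D↓ n ≡ pt D n
  pt-before n≤d = trans (pt-++-≤ d (E ∷ t ++ f) n≤d) (sym (pt-++-≤ d (t ++ E ∷ f) n≤d))

  pt-along : ∀ {n} → length d ≤ n → n ≤ length d + length t → pt D↓ (suc n) ≡ east (pt D n)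
  pt-along = go d
    where
    go : ∀ p {n} → length p ≤ n → n ≤ length p + length t →
         pt (p ++ E ∷ t ++ f) (suc n) ≡ east (pt (p ++ t ++ E ∷ f) n)
    go []      _         n≤t      = cong east (trans (pt-++-≤ t f n≤t) (sym (pt-++-≤ t (E ∷ f) n≤t)))
    go (N ∷ p) (s≤s p≤n) (s≤s n≤) = cong north (go p p≤n n≤)
    go (E ∷ p) (s≤s p≤n) (s≤s n≤) = cong east  (go p p≤n n≤)

  pt-after : ∀ {n} → suc (length d + length t) ≤ n → pt D↓ n ≡ pt D n
  pt-after = go d
    where
    go : ∀ p {n} → suc (length p + length t) ≤ n → pt (p ++ E ∷ t ++ f) n ≡ pt (p ++ t ++ E ∷ f) n
    go []      t<n                = pt-E-past t f t<n
    go (N ∷ p) {suc n} (s≤s p+t<n) = cong north (go p p+t<n)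
    go (E ∷ p) {suc n} (s≤s p+t<n) = cong east  (go p p+t<n)

  stepAt-along : ∀ {n} → length d ≤ n → n < length d + length t → stepAt D↓ (suc n) ≡ stepAt D n
  stepAt-along = go d
    where
    go : ∀ p {n} → length p ≤ n → n < length p + length t →
         stepAt (p ++ E ∷ t ++ f) (suc n) ≡ stepAt (p ++ t ++ E ∷ f) n
    go []      _         n<t      = trans (stepAt-++-< t f n<t) (sym (stepAt-++-< t (E ∷ f) n<t))
    go (_ ∷ p) (s≤s p≤n) (s≤s n<) = go p p≤n n<

  length-D↓ : length D↓ ≡ length d + suc (length t + length f)
  length-D↓ = trans (length-++ d) (cong (λ n → length d + suc n) (length-++ t))

  length-D : length D ≡ length d + (length t + suc (length f))
  length-D = trans (length-++ d) (cong (length d +_) (length-++ t))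

  length-D↓≡length-D : length D↓ ≡ length D
  length-D↓≡length-D = trans length-D↓ (trans (cong (length d +_) (sym (+-suc (length t) (length f)))) (sym length-D))

  touch<length : suc (length d + length t) ≤ length D↓
  touch<length = begin
    suc (length d + length t)             ≡⟨ sym (+-suc (length d) (length t)) ⟩
    length d + suc (length t)             ≤⟨ +-monoʳ-≤ (length d) (s≤s (m≤m+n (length t) (length f))) ⟩
    length d + suc (length t + length f)  ≡⟨ sym length-D↓ ⟩
    length D↓                             ∎
    where open ≤-Reasoning

  counts-D↓ : (countE D↓ , countN D↓) ≡ (countE D , countN D)
  counts-D↓ = begin
    (countE D↓ , countN D↓) ≡⟨ sym (pt-length D↓) ⟩
    pt D↓ (length D↓)       ≡⟨ pt-after touch<length ⟩
    pt D (length D↓)        ≡⟨ cong (pt D) length-D↓≡length-D ⟩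
    pt D (length D)         ≡⟨ pt-length D ⟩
    (countE D , countN D)   ∎
    where open ≡-Reasoning

  module Raising (ν : Path) {i : ℕ}
    (dy    : IsDyck ν D)
    (r     : RIdx D i (length d))
    (touch : TIdx ν D (length d) (length d + length t))
    (h≢0   : horiz ν (pt D (length d)) ≢ 0) where

    k m : ℕ
    k = length d
    m = length d + length t

    horiz-along≢0 : ∀ {n} → k ≤ n → n ≤ m → horiz ν (pt D n) ≢ 0
    horiz-along≢0 {n} k≤n n≤m h≡0 =
      h≢0 (n≤0⇒n≡0 (subst (horiz ν (pt D k) ≤_) h≡0 (horiz-≥-until-touch ν (proj₁ r) touch n k≤n n≤m)))

    horiz-along : ∀ {n} → k ≤ n → n ≤ m → horiz ν (pt D↓ (suc n)) ≡ pred (horiz ν (pt D n))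
    horiz-along {n} k≤n n≤m = trans (cong (horiz ν) (pt-along k≤n n≤m)) (horiz-east ν (pt D n))

    D-above : ∀ {n} → n ≤ length D↓ → Above ν (pt D n)
    D-above {n} n≤D↓ = proj₂ (proj₂ dy) n (subst (n ≤_) length-D↓≡length-D n≤D↓)

    D↓-above : ∀ n → n ≤ length D↓ → Above ν (pt D↓ n)
    D↓-above n n≤D↓ with n ≤? k
    ... | yes n≤k = subst (Above ν) (sym (pt-before n≤k)) (D-above n≤D↓)
    D↓-above zero    _    | no 0≰k = ⊥-elim (0≰k z≤n)
    D↓-above (suc n) n<D↓ | no n≮k with n ≤? m
    ... | yes n≤m = subst (Above ν) (sym (pt-along k≤n n≤m))
                          (horiz≢0⇒Above-east ν (pt D n) (horiz-along≢0 k≤n n≤m))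
      where k≤n = ≤-pred (≰⇒> n≮k)
    ... | no  n≰m = subst (Above ν) (sym (pt-after (m≤n⇒m≤1+n (≰⇒> n≰m)))) (D-above n<D↓)

    D↓-isDyck : IsDyck ν D↓
    D↓-isDyck = trans (cong proj₁ counts-D↓) (proj₁ dy)
              , trans (cong proj₂ counts-D↓) (proj₁ (proj₂ dy))
              , D↓-above

    D↓-reach : RIdx D↓ i (suc k)
    D↓-reach = trans (stepAt-along ≤-refl (proj₁ touch)) (proj₁ r)
             , trans (cong (suc ∘ proj₂) (pt-along ≤-refl (m≤m+n k (length t)))) (proj₂ r)

    D↓-touch : TIdx ν D↓ (suc k) (suc m)
    D↓-touch = s≤s (proj₁ touch) , touch<length , same-horiz , no-earlier
      where
      open ≡-Reasoning
      k≤m = m≤m+n k (length t)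
      same-horiz : horiz ν (pt D↓ (suc m)) ≡ horiz ν (pt D↓ (suc k))
      same-horiz = begin
        horiz ν (pt D↓ (suc m))   ≡⟨ horiz-along k≤m ≤-refl ⟩
        pred (horiz ν (pt D m))   ≡⟨ cong pred (proj₁ (proj₂ (proj₂ touch))) ⟩
        pred (horiz ν (pt D k))   ≡⟨ sym (horiz-along ≤-refl k≤m) ⟩
        horiz ν (pt D↓ (suc k))   ∎
      no-earlier : ∀ j → suc k < j → j < suc m → horiz ν (pt D↓ j) ≢ horiz ν (pt D↓ (suc k))
      no-earlier (suc j) (s≤s k<j) (s≤s j<m) same =
        proj₂ (proj₂ (proj₂ touch)) j k<j j<m
          (pred-injective ⦃ ≢-nonZero (horiz-along≢0 k≤j j≤m) ⦄ ⦃ ≢-nonZero h≢0 ⦄ (begin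
            pred (horiz ν (pt D j))   ≡⟨ sym (horiz-along k≤j j≤m) ⟩
            horiz ν (pt D↓ (suc j))   ≡⟨ same ⟩
            horiz ν (pt D↓ (suc k))   ≡⟨ horiz-along ≤-refl k≤m ⟩
            pred (horiz ν (pt D k))   ∎))
        where k≤j = <⇒≤ k<j
              j≤m = <⇒≤ j<m

    D↓-raises-to-D : Up ν D↓ i D
    D↓-raises-to-D = d , t , f , refl , D↓-reach , D↓-touch , refl

down-covered⇒touch-is-hit : ∀ ν {D i} →
  ∃[ D′ ] (Down ν D i D′ × Covers ν D′ D) → TouchIsHitNonzero ν D i
down-covered⇒touch-is-hit ν (_ , (d , t , f , refl , r , touch , hit , refl , (_ , _ , D↓-above)) , _) =
  length d , length d + length t , length d + length t , r , touch , hit , refl ,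
  Above-east⇒horiz≢0 ν (pt D (length d))
    (subst (Above ν) (pt-along ≤-refl (m≤m+n (length d) (length t)))
      (D↓-above (suc (length d)) (≤-trans (s≤s (m≤m+n (length d) (length t))) touch<length)))
  where open Lower d t f

touch-is-hit⇒down-covered : ∀ ν {D i} → IsDyck ν D → 1 ≤ i → i ≤ countN ν →
  TouchIsHitNonzero ν D i → ∃[ D′ ] (Down ν D i D′ × Covers ν D′ D)
touch-is-hit⇒down-covered ν {D} {i} dy 1≤i i≤n
  (k , m , m′ , r , touch@(k<m , m≤D , same-horiz , _) , hit@(_ , m′≤D , _ , hit-end , _) , t≡h , h≢0)
  with pt-injective D m≤D m′≤D t≡h
... | refl with split-before-E D (<⇒≤ k<m) (EndOrE⇒E ν dy (h≢0 ∘ trans (sym same-horiz)) hit-end)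
... | d , t , f , refl , refl , refl =
  D↓ , (d , t , f , refl , r , touch , hit , refl , D↓-isDyck) , (D↓-isDyck , dy , i , 1≤i , i≤n , D↓-raises-to-D)
  where open Lower d t f
        open Raising ν dy r touch h≢0

mainTheorem1 : (ν D : Path) (i : ℕ) → IsDyck ν D → 1 ≤ i → i ≤ countN ν →
    ((∃[ D' ] (Down ν D i D' × Covers ν D' D)) ⇔ TouchIsHitNonzero ν D i)
mainTheorem1 ν D i dy 1≤i i≤n = mk⇔ (down-covered⇒touch-is-hit ν) (touch-is-hit⇒down-covered ν dy 1≤i i≤n)
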